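{- Let $k,\ell$ be even positive integers with $k<\ell<\sqrt3k$, $\gcd(k,\ell)=2$, and exactly one of $k,\ell$ divisible by $4$. Let $u,v\ge0$ be integers with $k^2u-\ell^2v=\pm4$. Define integer-valued polynomials $d_1(n),d_2(n)$ as follows. If $u,v$ are both odd: if $u\equiv v\pmod 4$ set $d_1(n)=v+k^2(2n+1)$, $d_2(n)=u+\ell^2(2n+1)$; if $u\not\equiv v\pmod 4$ set $d_1(n)=v+k^2(2n+\tfrac12)$, $d_2(n)=u+\ell^2(2n+\tfrac12)$. If one of $u,v$ is even, let $u'$ be the even one and $v'$ the other; if $v'\equiv u'+1\pmod 4$ set $d_1(n)=v+k^2(n+\tfrac14)$, $d_2(n)=u+\ell^2(n+\tfrac14)$; if $v'\equiv u'+3\pmod4$ set $d_1(n)=v+k^2(n+\tfrac34)$, $d_2(n)=u+\ell^2(n+\tfrac34)$. Let $f(n)=d_1(n)d_2(n)$ and, for a prime $p$, let $w_f(p)$ be the number of integers $a$ with $1\le a\le p^2$ such that $f(a)\equiv0\pmod{p^2}$. Then $w_f(2)=0$; for odd primes $p$ with $p\mid k$ or $p\mid\ell$ one has $w_f(p)=1$; and for all other primes $w_f(p)=2$.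
   Context: Here $u,v$ are as produced by the extended Euclidean algorithm: $u=|g_0|$, $v=|h_0|$ for integers $g_0,h_0$ with $k^2g_0+\ell^2h_0=4$. -}

module Defs where

open import Data.Nat using (ℕ; zero; suc; _+_; _*_; _≡ᵇ_; _%_; _/_)
open import Data.Nat.Divisibility using (_∣_; _∣?_)
open import Data.Bool using (Bool; true; false; if_then_else_; _∧_)
open import Data.List using (List; length; filter; map; upTo)

data Case : Set where
  caseA caseB caseC caseD : Case

odd? : ℕ → Bool
odd? n = n % 2 ≡ᵇ 1

-- Case selection from (u, v).  If u is even we take u' = u, v' = v,
-- otherwise u' = v, v' = u.  (Both even is excluded by the hypotheses.)
caseOf : ℕ → ℕ → Case
caseOf u v =
  if odd? u ∧ odd? v
  then (if u % 4 ≡ᵇ v % 4 then caseA else caseB)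
  else (if odd? u then sel v u else sel u v)
  where
  sel : ℕ → ℕ → Case
  sel u' v' = if v' % 4 ≡ᵇ (u' + 1) % 4 then caseC else caseD

-- dgen cs x c n = x + c² · (shift polynomial in n); c is even so the
-- divisions by 2 and 4 below are exact.
dgen : Case → ℕ → ℕ → ℕ → ℕ
dgen caseA x c n = x + c * c * (2 * n + 1)
dgen caseB x c n = x + c * c * (2 * n) + (c * c) / 2
dgen caseC x c n = x + c * c * n + (c * c) / 4
dgen caseD x c n = x + c * c * n + 3 * ((c * c) / 4)

d₁ : (k ℓ u v : ℕ) → ℕ → ℕ
d₁ k ℓ u v n = dgen (caseOf u v) v k n

d₂ : (k ℓ u v : ℕ) → ℕ → ℕ
d₂ k ℓ u v n = dgen (caseOf u v) u ℓ n

f : (k ℓ u v : ℕ) → ℕ → ℕ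
f k ℓ u v n = d₁ k ℓ u v n * d₂ k ℓ u v n

w : (k ℓ u v : ℕ) → ℕ → ℕ
w k ℓ u v p = length (filter (λ a → (p * p) ∣? f k ℓ u v a) (map suc (upTo (p * p))))

{-# OPTIONS --safe #-}
module Submission where

-- Write k = 2K and ℓ = 2L.  The hypothesis becomes K²u − L²v = ±1, and
-- d₁(n) = v + K²T(n), d₂(n) = u + L²T(n) with T(n) = αn + β, α ∈ {4, 8}.
-- Then K²d₂(n) − L²d₁(n) = ±1, so d₁(n) and d₂(n) are coprime, p² ∣ f(n)
-- iff p² divides exactly one of them, and w_f(p) = w_{d₁}(p) + w_{d₂}(p).
-- For odd p, d₁ is linear with slope K²α: if p ∤ K the slope is a unit mod
-- p² and d₁ has exactly one root, while if p ∣ K then d₁ ≡ v ≢ 0 (mod p)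
-- has none; likewise for d₂.  For p = 2, exactly one of K, L is even, and
-- the case distinction makes T(n) even exactly when u and v are both odd;
-- this forces d₁(n) and d₂(n) to be odd.

open import Defs
open import Data.Nat using (ℕ; zero; suc; _+_; _*_; _^_; _<_; _≤_; _%_; _/_; _≡ᵇ_; s≤s; NonZero)
open import Data.Nat.Properties
open import Data.Nat.Divisibility
open import Data.Nat.DivMod using (m≡m%n+[m/n]*n; m%n<n; m*n/n≡m)
open import Data.Nat.GCD using (gcd; module Bézout)
open import Data.Nat.Coprimality using (Coprime; coprime-Bézout; coprime-divisor)
import Data.Nat.Coprimality as Coprime
open import Data.Nat.Primality
  using (Prime; euclidsLemma; prime⇒irreducible; prime⇒nonZero; irreducible[2]; ¬prime[1]; prime[2])
open import Data.Nat.Tactic.RingSolver using (solve-∀)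
open import Data.Integer as ℤ using (+_)
import Data.Integer.Properties as ℤP
import Data.Integer.Tactic.RingSolver as ℤ-Solver
open import Data.Bool using (true; false; _∧_; if_then_else_)
open import Data.Bool.Properties using (∧-zeroʳ)
open import Data.List using (List; []; _∷_; length; filter; map; upTo)
open import Data.List.Properties using (filter-none; filter-≐)
open import Data.List.Membership.Propositional using (_∈_)
open import Data.List.Membership.Propositional.Properties
  using (∈-map⁺; ∈-map⁻; ∈-upTo⁺; ∈-upTo⁻; ∈-filter⁺; ∈-filter⁻)
open import Data.List.Relation.Unary.All using (_∷_)
import Data.List.Relation.Unary.All as All
open import Data.List.Relation.Unary.AllPairs using (_∷_)
open import Data.List.Relation.Unary.Any using (here; there)
open import Data.List.Relation.Unary.Unique.Propositional using (Unique)
import Data.List.Relation.Unary.Unique.Propositional.Properties as Unique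
open import Data.Product using (_×_; _,_; proj₁; proj₂; ∃; ∃₂; swap)
import Data.Product as Product
open import Data.Sum using (_⊎_; inj₁; inj₂; [_,_]′)
import Data.Sum as Sum
open import Data.Empty using (⊥-elim)
open import Relation.Nullary using (¬_; yes; no)
open import Relation.Unary using (Pred; Decidable; _≐_; _∪_)
open import Relation.Binary.PropositionalEquality
open import Function using (_∘_)
open ≡-Reasoning

unique-constant⇒length≡1 : ∀ {a} {A : Set a} {xs : List A} {x : A} →
  Unique xs → x ∈ xs → (∀ {y} → y ∈ xs → y ≡ x) → length xs ≡ 1
unique-constant⇒length≡1 {xs = _ ∷ []}    _                 _ _  = refl
unique-constant⇒length≡1 {xs = _ ∷ _ ∷ _} ((y≢z ∷ _) ∷ _) _ ≡x =
  ⊥-elim (y≢z (trans (≡x (here refl)) (sym (≡x (there (here refl))))))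

module _ {a p} {A : Set a} {P : Pred A p} (P? : Decidable P) where

  length-filter≡1 : ∀ {xs x} → Unique xs → x ∈ xs → P x →
    (∀ {y} → y ∈ xs → P y → y ≡ x) → length (filter P? xs) ≡ 1
  length-filter≡1 xs! x∈xs Px only-x =
    unique-constant⇒length≡1 (Unique.filter⁺ P? xs!) (∈-filter⁺ P? x∈xs Px)
      (λ y∈ → let y∈xs , Py = ∈-filter⁻ P? y∈ in only-x y∈xs Py)

module _ {a p q r} {A : Set a} {P : Pred A p} {Q : Pred A q} {R : Pred A r}
         (P? : Decidable P) (Q? : Decidable Q) (R? : Decidable R)
         (P≐Q∪R : P ≐ Q ∪ R) (Q∩R=∅ : ∀ {x} → Q x → ¬ R x) where

  length-filter-∪ : ∀ xs →
    length (filter P? xs) ≡ length (filter Q? xs) + length (filter R? xs)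
  length-filter-∪ []       = refl
  length-filter-∪ (x ∷ xs) with P? x | Q? x | R? x
  ... | yes _  | yes _  | no _   = cong suc (length-filter-∪ xs)
  ... | yes _  | no _   | yes _  = trans (cong suc (length-filter-∪ xs)) (sym (+-suc _ _))
  ... | yes Px | no ¬Qx | no ¬Rx = ⊥-elim ([ ¬Qx , ¬Rx ]′ (proj₁ P≐Q∪R Px))
  ... | _      | yes Qx | yes Rx = ⊥-elim (Q∩R=∅ Qx Rx)
  ... | no ¬Px | yes Qx | no _   = ⊥-elim (¬Px (proj₂ P≐Q∪R (inj₁ Qx)))
  ... | no ¬Px | no _   | yes Rx = ⊥-elim (¬Px (proj₂ P≐Q∪R (inj₂ Rx)))
  ... | no _   | no _   | no _   = length-filter-∪ xs

∤m∣n⇒∤m+n : ∀ {d m n} → ¬ d ∣ m → d ∣ n → ¬ d ∣ m + n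
∤m∣n⇒∤m+n {d} {m} {n} d∤m d∣n d∣m+n = d∤m (∣m+n∣m⇒∣n (subst (d ∣_) (+-comm m n) d∣m+n) d∣n)

∣m∤n⇒∤m+n : ∀ {d m n} → d ∣ m → ¬ d ∣ n → ¬ d ∣ m + n
∣m∤n⇒∤m+n d∣m d∤n d∣m+n = d∤n (∣m+n∣m⇒∣n d∣m+n d∣m)

∣⇒∣square* : ∀ {d} A x → d ∣ A → d ∣ A * A * x
∣⇒∣square* A x d∣A = ∣m⇒∣m*n x (∣m⇒∣m*n A d∣A)

∣∧<⇒≡0 : ∀ {n t} → n ∣ t → t < n → t ≡ 0
∣∧<⇒≡0 {t = zero}  _   _   = refl
∣∧<⇒≡0 {t = suc _} n∣t t<n = ⊥-elim (>⇒∤ t<n n∣t)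

coprime-divisors : ∀ {m n d e} → Coprime m n → d ∣ m → e ∣ n → Coprime d e
coprime-divisors m⊥n d∣m e∣n (c∣d , c∣e) = m⊥n (∣-trans c∣d d∣m , ∣-trans c∣e e∣n)

coprime-*ˡ : ∀ {m n o} → Coprime m o → Coprime n o → Coprime (m * n) o
coprime-*ˡ {m} {n} {o} m⊥o n⊥o {d} (d∣mn , d∣o) =
  m⊥o (coprime-divisor d⊥n (subst (d ∣_) (*-comm m n) d∣mn) , d∣o)
  where
  d⊥n : Coprime d n
  d⊥n (c∣d , c∣n) = n⊥o (c∣n , ∣-trans c∣d d∣o)

module _ {p : ℕ} (p-prime : Prime p) where

  prime≢1 : p ≢ 1
  prime≢1 p≡1 = ¬prime[1] (subst Prime p≡1 p-prime)

  prime∤1 : ¬ p ∣ 1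
  prime∤1 p∣1 = prime≢1 (∣1⇒≡1 p∣1)

  prime∤* : ∀ {m n} → ¬ p ∣ m → ¬ p ∣ n → ¬ p ∣ m * n
  prime∤* {m} {n} p∤m p∤n p∣mn = [ p∤m , p∤n ]′ (euclidsLemma m n p-prime p∣mn)

  coprime⇒prime∤ : ∀ {m n} → Coprime m n → p ∣ m → ¬ p ∣ n
  coprime⇒prime∤ m⊥n p∣m p∣n = prime≢1 (m⊥n (p∣m , p∣n))

  prime∤⇒coprime : ∀ {n} → ¬ p ∣ n → Coprime p n
  prime∤⇒coprime p∤n (d∣p , d∣n) with prime⇒irreducible p-prime d∣p
  ... | inj₁ d≡1 = d≡1
  ... | inj₂ refl = ⊥-elim (p∤n d∣n)

  prime∤⇒coprime-square : ∀ {n} → ¬ p ∣ n → Coprime (p * p) n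
  prime∤⇒coprime-square p∤n = coprime-*ˡ (prime∤⇒coprime p∤n) (prime∤⇒coprime p∤n)

  prime²∣*-coprime : ∀ {m n} → Coprime m n → p * p ∣ m * n → p * p ∣ m ⊎ p * p ∣ n
  prime²∣*-coprime {m} {n} m⊥n p²∣mn with euclidsLemma m n p-prime (∣-trans (m∣m*n p) p²∣mn)
  ... | inj₁ p∣m = inj₁ (coprime-divisor (prime∤⇒coprime-square (coprime⇒prime∤ m⊥n p∣m))
                                         (subst (p * p ∣_) (*-comm m n) p²∣mn))
  ... | inj₂ p∣n = inj₂ (coprime-divisor (prime∤⇒coprime-square (coprime⇒prime∤ (Coprime.sym m⊥n) p∣n))
                                         p²∣mn)

  odd-prime∤2^ : p ≢ 2 → ∀ j → ¬ p ∣ 2 ^ j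
  odd-prime∤2^ p≢2 zero = prime∤1
  odd-prime∤2^ p≢2 (suc j) p∣2^[1+j] with euclidsLemma 2 (2 ^ j) p-prime p∣2^[1+j]
  ... | inj₂ p∣2^j = odd-prime∤2^ p≢2 j p∣2^j
  ... | inj₁ p∣2 = [ prime≢1 , p≢2 ]′ (irreducible[2] p∣2)

  odd-prime∣*2⇒∣ : p ≢ 2 → ∀ {n} → p ∣ n * 2 → p ∣ n
  odd-prime∣*2⇒∣ p≢2 {n} p∣2n = [ (λ p∣n → p∣n) , (λ p∣2 → ⊥-elim (odd-prime∤2^ p≢2 1 p∣2)) ]′
                                   (euclidsLemma n 2 p-prime p∣2n)

Adjacent : ℕ → ℕ → Set
Adjacent m n = m ≡ n + 1 ⊎ n ≡ m + 1

adjacent⇒coprime : ∀ {m n} → Adjacent m n → Coprime m n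
adjacent⇒coprime (inj₁ refl) (d∣n+1 , d∣n) = ∣1⇒≡1 (∣m+n∣m⇒∣n d∣n+1 d∣n)
adjacent⇒coprime (inj₂ refl) (d∣m , d∣m+1) = ∣1⇒≡1 (∣m+n∣m⇒∣n d∣m+1 d∣m)

adjacent-+ : ∀ {m n} o → Adjacent m n → Adjacent (o + m) (o + n)
adjacent-+ {n = n} o (inj₁ refl) = inj₁ (sym (+-assoc o n 1))
adjacent-+ {m = m} o (inj₂ refl) = inj₂ (sym (+-assoc o m 1))

adjacent⇒coprime-shifted : ∀ {A B x y} → Adjacent (A * A * x) (B * B * y) →
  ∀ T → Coprime (y + A * A * T) (x + B * B * T)
adjacent⇒coprime-shifted {A} {B} {x} {y} adj T =
  Coprime.sym (coprime-divisors (adjacent⇒coprime shifted) (n∣m*n (A * A)) (n∣m*n (B * B)))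
  where
  distribˡ : ∀ A B x T → A * A * (B * B * T) + A * A * x ≡ A * A * (x + B * B * T)
  distribˡ = solve-∀
  distribʳ : ∀ A B y T → A * A * (B * B * T) + B * B * y ≡ B * B * (y + A * A * T)
  distribʳ = solve-∀
  shifted : Adjacent (A * A * (x + B * B * T)) (B * B * (y + A * A * T))
  shifted = subst₂ Adjacent (distribˡ A B x T) (distribʳ A B y T) (adjacent-+ (A * A * (B * B * T)) adj)

ℤ-difference≡±4 : ∀ m n → + m ℤ.- + n ≡ + 4 ⊎ + m ℤ.- + n ≡ ℤ.- + 4 → m ≡ n + 4 ⊎ n ≡ m + 4
ℤ-difference≡±4 m n (inj₁ m-n≡4) =
  inj₁ (ℤP.+-injective (trans (i≡j+[i-j] (+ m) (+ n)) (cong (λ t → + n ℤ.+ t) m-n≡4)))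
  where
  i≡j+[i-j] : ∀ i j → i ≡ j ℤ.+ (i ℤ.- j)
  i≡j+[i-j] = ℤ-Solver.solve-∀
ℤ-difference≡±4 m n (inj₂ m-n≡-4) =
  inj₂ (ℤP.+-injective (trans (j≡i-[i-j] (+ m) (+ n)) (cong (λ t → + m ℤ.- t) m-n≡-4)))
  where
  j≡i-[i-j] : ∀ i j → j ≡ i ℤ.- (i ℤ.- j)
  j≡i-[i-j] = ℤ-Solver.solve-∀

adjacent-halves : ∀ K L u v →
  + (K * 2 * (K * 2) * u) ℤ.- + (L * 2 * (L * 2) * v) ≡ + 4 ⊎
  + (K * 2 * (K * 2) * u) ℤ.- + (L * 2 * (L * 2) * v) ≡ ℤ.- + 4 →
  Adjacent (K * K * u) (L * L * v)
adjacent-halves K L u v ±4 =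
  Sum.map (quarter (K * K * u) (L * L * v)) (quarter (L * L * v) (K * K * u))
    (subst₂ (λ m n → m ≡ n + 4 ⊎ n ≡ m + 4) (square-*2 K u) (square-*2 L v) (ℤ-difference≡±4 _ _ ±4))
  where
  square-*2 : ∀ K u → K * 2 * (K * 2) * u ≡ 4 * (K * K * u)
  square-*2 = solve-∀
  quarter : ∀ a b → 4 * a ≡ 4 * b + 4 → a ≡ b + 1
  quarter a b eq = *-cancelˡ-≡ a (b + 1) 4 (trans eq (sym (*-distribˡ-+ 4 b 1)))

range : ℕ → List ℕ
range N = map suc (upTo N)

range-unique : ∀ N → Unique (range N)
range-unique N = Unique.map⁺ suc-injective (Unique.upTo⁺ N)

∈-range⁻ : ∀ {N a} → a ∈ range N → ∃ λ i → i < N × a ≡ suc i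
∈-range⁻ a∈ = let i , i∈ , a≡1+i = ∈-map⁻ suc a∈ in i , ∈-upTo⁻ i∈ , a≡1+i

∈-range-representative : ∀ N .{{_ : NonZero N}} b → ∃₂ λ a q → a ∈ range N × a + q * N ≡ b + N
∈-range-representative N@(suc r) b =
  suc i , q , ∈-map⁺ suc (∈-upTo⁺ (m%n<n (b + r) N)) , (begin
    suc (i + q * N) ≡⟨ cong suc (m≡m%n+[m/n]*n (b + r) N) ⟨
    suc (b + r)     ≡⟨ +-suc b r ⟨
    b + N           ∎)
  where
  i = (b + r) % N
  q = (b + r) / N

rootCount : ℕ → (ℕ → ℕ) → ℕ
rootCount N g = length (filter (λ a → N ∣? g a) (range N))

rootCount-cong : ∀ N {g h} → (∀ a → g a ≡ h a) → rootCount N g ≡ rootCount N h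
rootCount-cong N {g} {h} g≗h = cong length (filter-≐ (λ a → N ∣? g a) (λ a → N ∣? h a)
  ((λ {a} → subst (N ∣_) (g≗h a)) , (λ {a} → subst (N ∣_) (sym (g≗h a)))) (range N))

rootCount-none : ∀ N {g} → (∀ a → ¬ N ∣ g a) → rootCount N g ≡ 0
rootCount-none N {g} N∤g = cong length (filter-none (λ a → N ∣? g a) {range N} (All.tabulate (λ {a} _ → N∤g a)))

rootCount-* : ∀ {p} → Prime p → ∀ g h → (∀ a → Coprime (g a) (h a)) →
  rootCount (p * p) (λ a → g a * h a) ≡ rootCount (p * p) g + rootCount (p * p) h
rootCount-* {p} p-prime g h g⊥h =
  length-filter-∪ (λ a → p * p ∣? g a * h a) (λ a → p * p ∣? g a) (λ a → p * p ∣? h a)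
    ((λ {a} → prime²∣*-coprime p-prime (g⊥h a)) , (λ {a} → [ ∣m⇒∣m*n (h a) , ∣n⇒∣m*n (g a) ]′))
    (λ {a} p²∣g p²∣h → coprime⇒prime∤ p-prime (g⊥h a) (∣-trans (m∣m*n p) p²∣g) (∣-trans (m∣m*n p) p²∣h))
    (range (p * p))

∣-linear-resp-mod : ∀ {N M e a b x y} → N ∣ x → N ∣ y → a + x ≡ b + y →
  N ∣ M * b + e → N ∣ M * a + e
∣-linear-resp-mod {N} {M} {e} {a} {b} {x} {y} N∣x N∣y a+x≡b+y N∣Mb+e =
  ∣m+n∣m⇒∣n (subst (N ∣_) shifted (∣m∣n⇒∣m+n (∣n⇒∣m*n M N∣y) N∣Mb+e)) (∣n⇒∣m*n M N∣x)
  where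
  rearrange : ∀ M x a e → M * x + (M * a + e) ≡ M * (a + x) + e
  rearrange = solve-∀
  shifted : M * y + (M * b + e) ≡ M * x + (M * a + e)
  shifted = begin
    M * y + (M * b + e) ≡⟨ rearrange M y b e ⟩
    M * (b + y) + e     ≡⟨ cong (λ t → M * t + e) a+x≡b+y ⟨
    M * (a + x) + e     ≡⟨ rearrange M x a e ⟨
    M * x + (M * a + e) ∎

∣-linear-difference : ∀ {N M e a t} → Coprime M N → N ∣ M * a + e → N ∣ M * (a + t) + e → N ∣ t
∣-linear-difference {N} {M} {e} {a} {t} M⊥N N∣Ma+e N∣M[a+t]+e =
  coprime-divisor (Coprime.sym M⊥N)
    (∣m+n∣m⇒∣n (subst (N ∣_) (expand M a t e) N∣M[a+t]+e) N∣Ma+e)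
  where
  expand : ∀ M a t e → M * (a + t) + e ≡ M * a + e + M * t
  expand = solve-∀

-- Bézout gives x with x·M ≡ ∓1 (mod N); take z = x, or z = (N − 1)·x ≡ −x.
coprime⇒∣*+1 : ∀ {M N} .{{_ : NonZero N}} → Coprime M N → ∃ λ z → N ∣ M * z + 1
coprime⇒∣*+1 {M} {N@(suc r)} M⊥N with coprime-Bézout M⊥N
... | Bézout.-+ x y 1+xM≡yN = x , divides y (trans (reorder M x) 1+xM≡yN)
  where
  reorder : ∀ M x → M * x + 1 ≡ 1 + x * M
  reorder = solve-∀
... | Bézout.+- x y 1+yN≡xM = r * x , divides (1 + r * y) (begin
  M * (r * x) + 1       ≡⟨ reorder M r x ⟩
  r * (x * M) + 1       ≡⟨ cong (λ t → r * t + 1) 1+yN≡xM ⟨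
  r * (1 + y * N) + 1   ≡⟨ collect r y ⟩
  (1 + r * y) * N       ∎)
  where
  reorder : ∀ M r x → M * (r * x) + 1 ≡ r * (x * M) + 1
  reorder = solve-∀
  collect : ∀ r y → r * (1 + y * suc r) + 1 ≡ (1 + r * y) * suc r
  collect = solve-∀

module _ {M N : ℕ} .{{_ : NonZero N}} (e : ℕ) (M⊥N : Coprime M N) where

  linear-root : ∃ λ a → a ∈ range N × N ∣ M * a + e
  linear-root =
    let z , N∣Mz+1 = coprime⇒∣*+1 M⊥N
        a , q , a∈ , a+qN≡ez+N = ∈-range-representative N (e * z)
    in a , a∈ , ∣-linear-resp-mod {M = M} (n∣m*n q) ∣-refl a+qN≡ez+N
                  (subst (N ∣_) (distrib e M z) (∣n⇒∣m*n e N∣Mz+1))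
    where
    distrib : ∀ e M z → e * (M * z + 1) ≡ M * (e * z) + e
    distrib = solve-∀

  linear-root-unique-≤ : ∀ {i j} → i ≤ j → j < N →
    N ∣ M * suc i + e → N ∣ M * suc j + e → i ≡ j
  linear-root-unique-≤ {i} {j} i≤j j<N N∣M[1+i]+e N∣M[1+j]+e = ≤-antisym i≤j (m∸n≡0⇒m≤n
    (∣∧<⇒≡0 (∣-linear-difference M⊥N N∣M[1+i]+e
               (subst (λ b → N ∣ M * suc b + e) (sym (m+[n∸m]≡n i≤j)) N∣M[1+j]+e))
            (≤-<-trans (m∸n≤m j i) j<N)))

  linear-root-unique : ∀ {a b} → a ∈ range N → b ∈ range N →
    N ∣ M * a + e → N ∣ M * b + e → a ≡ b
  linear-root-unique a∈ b∈ N∣Ma+e N∣Mb+e with ∈-range⁻ a∈ | ∈-range⁻ b∈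
  ... | i , i<N , refl | j , j<N , refl with ≤-total i j
  ...   | inj₁ i≤j = cong suc (linear-root-unique-≤ i≤j j<N N∣Ma+e N∣Mb+e)
  ...   | inj₂ j≤i = cong suc (sym (linear-root-unique-≤ j≤i i<N N∣Mb+e N∣Ma+e))

  rootCount-linear : rootCount N (λ a → M * a + e) ≡ 1
  rootCount-linear =
    let a , a∈ , N∣Ma+e = linear-root
    in length-filter≡1 (λ a → N ∣? M * a + e) (range-unique N) a∈ N∣Ma+e
         (λ b∈ N∣Mb+e → linear-root-unique b∈ a∈ N∣Mb+e N∣Ma+e)

slope : Case → ℕ
slope caseA = 8
slope caseB = 8
slope caseC = 4
slope caseD = 4

offset : Case → ℕ
offset caseA = 4
offset caseB = 2
offset caseC = 1
offset caseD = 3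

shift : Case → ℕ → ℕ
shift cs n = slope cs * n + offset cs

d : Case → ℕ → ℕ → ℕ → ℕ
d cs x A n = x + A * A * shift cs n

square-*2/2 : ∀ A → A * 2 * (A * 2) / 2 ≡ A * A * 2
square-*2/2 A = trans (cong (_/ 2) (square A)) (m*n/n≡m (A * A * 2) 2)
  where
  square : ∀ A → A * 2 * (A * 2) ≡ A * A * 2 * 2
  square = solve-∀

square-*2/4 : ∀ A → A * 2 * (A * 2) / 4 ≡ A * A
square-*2/4 A = trans (cong (_/ 4) (square A)) (m*n/n≡m (A * A) 4)
  where
  square : ∀ A → A * 2 * (A * 2) ≡ A * A * 4
  square = solve-∀

dgen-*2 : ∀ cs x A n → dgen cs x (A * 2) n ≡ d cs x A n
dgen-*2 caseA x A n = expand x A n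
  where
  expand : ∀ x A n → x + A * 2 * (A * 2) * (2 * n + 1) ≡ x + A * A * (8 * n + 4)
  expand = solve-∀
dgen-*2 caseB x A n = trans (cong (λ t → x + A * 2 * (A * 2) * (2 * n) + t) (square-*2/2 A)) (expand x A n)
  where
  expand : ∀ x A n → x + A * 2 * (A * 2) * (2 * n) + A * A * 2 ≡ x + A * A * (8 * n + 2)
  expand = solve-∀
dgen-*2 caseC x A n = trans (cong (λ t → x + A * 2 * (A * 2) * n + t) (square-*2/4 A)) (expand x A n)
  where
  expand : ∀ x A n → x + A * 2 * (A * 2) * n + A * A ≡ x + A * A * (4 * n + 1)
  expand = solve-∀
dgen-*2 caseD x A n = trans (cong (λ t → x + A * 2 * (A * 2) * n + 3 * t) (square-*2/4 A)) (expand x A n)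
  where
  expand : ∀ x A n → x + A * 2 * (A * 2) * n + 3 * (A * A) ≡ x + A * A * (4 * n + 3)
  expand = solve-∀

d-linear : ∀ cs x A n → d cs x A n ≡ A * A * slope cs * n + (x + A * A * offset cs)
d-linear cs x A n = rearrange x A (slope cs) (offset cs) n
  where
  rearrange : ∀ x A α β n → x + A * A * (α * n + β) ≡ A * A * α * n + (x + A * A * β)
  rearrange = solve-∀

odd-prime∤slope : ∀ {p} → Prime p → p ≢ 2 → ∀ cs → ¬ p ∣ slope cs
odd-prime∤slope p-prime p≢2 caseA = odd-prime∤2^ p-prime p≢2 3
odd-prime∤slope p-prime p≢2 caseB = odd-prime∤2^ p-prime p≢2 3
odd-prime∤slope p-prime p≢2 caseC = odd-prime∤2^ p-prime p≢2 2
odd-prime∤slope p-prime p≢2 caseD = odd-prime∤2^ p-prime p≢2 2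

rootCount-d-unit : ∀ {p} → Prime p → p ≢ 2 → ∀ cs x {A} → ¬ p ∣ A → rootCount (p * p) (d cs x A) ≡ 1
rootCount-d-unit {p} p-prime p≢2 cs x {A} p∤A =
  trans (rootCount-cong (p * p) (d-linear cs x A))
        (rootCount-linear (x + A * A * offset cs) (Coprime.sym (prime∤⇒coprime-square p-prime p∤slope)))
  where
  instance
    p≢0 : NonZero p
    p≢0 = prime⇒nonZero p-prime
    p²≢0 : NonZero (p * p)
    p²≢0 = m*n≢0 p p
  p∤slope : ¬ p ∣ A * A * slope cs
  p∤slope = prime∤* p-prime (prime∤* p-prime p∤A p∤A) (odd-prime∤slope p-prime p≢2 cs)

rootCount-d-zero : ∀ {p} cs {x A} → p ∣ A → ¬ p ∣ x → rootCount (p * p) (d cs x A) ≡ 0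
rootCount-d-zero {p} cs {x} {A} p∣A p∤x = rootCount-none (p * p) (λ n p²∣d →
  ∤m∣n⇒∤m+n p∤x (∣⇒∣square* A (shift cs n) p∣A) (∣-trans (m∣m*n p) p²∣d))

odd?-true : ∀ {n} → ¬ 2 ∣ n → odd? n ≡ true
odd?-true {n} 2∤n with n % 2 in n%2≡r | m%n<n n 2
... | 0           | _ = ⊥-elim (2∤n (m%n≡0⇒n∣m n 2 n%2≡r))
... | 1           | _ = refl
... | suc (suc _) | s≤s (s≤s ())

odd?-false : ∀ {n} → 2 ∣ n → odd? n ≡ false
odd?-false {n} 2∣n rewrite n∣m⇒m%n≡0 n 2 2∣n = refl

not-both-odd? : ∀ {u v} → 2 ∣ u ⊎ 2 ∣ v → odd? u ∧ odd? v ≡ false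
not-both-odd? (inj₁ 2∣u) rewrite odd?-false 2∣u = refl
not-both-odd? {u} (inj₂ 2∣v) rewrite odd?-false 2∣v = ∧-zeroʳ (odd? u)

if-CD : ∀ b → (if b then caseC else caseD) ≡ caseC ⊎ (if b then caseC else caseD) ≡ caseD
if-CD true  = inj₁ refl
if-CD false = inj₂ refl

caseOf-both-odd : ∀ {u v} → ¬ 2 ∣ u → ¬ 2 ∣ v → caseOf u v ≡ caseA ⊎ caseOf u v ≡ caseB
caseOf-both-odd {u} {v} 2∤u 2∤v rewrite odd?-true 2∤u | odd?-true 2∤v with u % 4 ≡ᵇ v % 4
... | true  = inj₁ refl
... | false = inj₂ refl

caseOf-some-even : ∀ {u v} → 2 ∣ u ⊎ 2 ∣ v → caseOf u v ≡ caseC ⊎ caseOf u v ≡ caseD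
caseOf-some-even {u} {v} some-even rewrite not-both-odd? some-even with odd? u
... | true  = if-CD _
... | false = if-CD _

≡k*2+1⇒2∤ : ∀ {m} k → m ≡ k * 2 + 1 → ¬ 2 ∣ m
≡k*2+1⇒2∤ k refl = ∣m∤n⇒∤m+n (n∣m*n k) (prime∤1 prime[2])

shift-even : ∀ {u v} → ¬ 2 ∣ u → ¬ 2 ∣ v → ∀ n → 2 ∣ shift (caseOf u v) n
shift-even {u} {v} 2∤u 2∤v n with caseOf u v | caseOf-both-odd 2∤u 2∤v
... | .caseA | inj₁ refl = divides (4 * n + 2) (split n)
  where
  split : ∀ n → 8 * n + 4 ≡ (4 * n + 2) * 2
  split = solve-∀
... | .caseB | inj₂ refl = divides (4 * n + 1) (split n)
  where
  split : ∀ n → 8 * n + 2 ≡ (4 * n + 1) * 2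
  split = solve-∀

shift-odd : ∀ {u v} → 2 ∣ u ⊎ 2 ∣ v → ∀ n → ¬ 2 ∣ shift (caseOf u v) n
shift-odd {u} {v} some-even n with caseOf u v | caseOf-some-even some-even
... | .caseC | inj₁ refl = ≡k*2+1⇒2∤ (2 * n) (split n)
  where
  split : ∀ n → 4 * n + 1 ≡ 2 * n * 2 + 1
  split = solve-∀
... | .caseD | inj₂ refl = ≡k*2+1⇒2∤ (2 * n + 1) (split n)
  where
  split : ∀ n → 4 * n + 3 ≡ (2 * n + 1) * 2 + 1
  split = solve-∀

-- T stands for shift (caseOf u v) n, kept abstract so that (K, u) and (L, v) may swap roles.
d-odd : ∀ {A B x y T} → 2 ∣ A → ¬ 2 ∣ B → Coprime (A * A * x) (B * B * y) →
  (¬ 2 ∣ x → ¬ 2 ∣ y → 2 ∣ T) → (2 ∣ x → ¬ 2 ∣ T) →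
  ¬ 2 ∣ y + A * A * T × ¬ 2 ∣ x + B * B * T
d-odd {A} {B} {x} {y} {T} 2∣A 2∤B Ax⊥By T-even T-odd = ∤m∣n⇒∤m+n 2∤y (∣⇒∣square* A T 2∣A) , 2∤x+B*B*T
  where
  2∤y : ¬ 2 ∣ y
  2∤y = coprime⇒prime∤ prime[2] Ax⊥By (∣⇒∣square* A x 2∣A) ∘ ∣n⇒∣m*n (B * B)
  2∤x+B*B*T : ¬ 2 ∣ x + B * B * T
  2∤x+B*B*T with 2 ∣? x
  ... | yes 2∣x = ∣m∤n⇒∤m+n 2∣x (prime∤* prime[2] (prime∤* prime[2] 2∤B 2∤B) (T-odd 2∣x))
  ... | no  2∤x = ∤m∣n⇒∤m+n 2∤x (∣n⇒∣m*n (B * B) (T-even 2∤x 2∤y))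

4∣*2⇒2∣ : ∀ {n} → 4 ∣ n * 2 → 2 ∣ n
4∣*2⇒2∣ = *-cancelʳ-∣ 2

2∣⇒4∣*2 : ∀ {n} → 2 ∣ n → 4 ∣ n * 2
2∣⇒4∣*2 = *-monoˡ-∣ 2

module Halves (K L u v : ℕ) (adj : Adjacent (K * K * u) (L * L * v)) where

  private
    cs : Case
    cs = caseOf u v

    K²u⊥L²v : Coprime (K * K * u) (L * L * v)
    K²u⊥L²v = adjacent⇒coprime adj

  f-halves : ∀ n → f (K * 2) (L * 2) u v n ≡ d cs v K n * d cs u L n
  f-halves n = cong₂ _*_ (dgen-*2 cs v K n) (dgen-*2 cs u L n)

  w-split : ∀ {p} → Prime p →
    w (K * 2) (L * 2) u v p ≡ rootCount (p * p) (d cs v K) + rootCount (p * p) (d cs u L)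
  w-split {p} p-prime =
    trans (rootCount-cong (p * p) {f (K * 2) (L * 2) u v} f-halves)
          (rootCount-* p-prime (d cs v K) (d cs u L)
             (λ n → adjacent⇒coprime-shifted {K} {L} {u} {v} adj (shift cs n)))

  module _ {p} (p-prime : Prime p) (p≢2 : p ≢ 2) where

    w-∣K : p ∣ K → w (K * 2) (L * 2) u v p ≡ 1
    w-∣K p∣K = trans (w-split p-prime)
      (cong₂ _+_ (rootCount-d-zero cs p∣K (p∤L*L*v ∘ ∣n⇒∣m*n (L * L)))
                 (rootCount-d-unit p-prime p≢2 cs u (p∤L*L*v ∘ ∣⇒∣square* L v)))
      where
      p∤L*L*v : ¬ p ∣ L * L * v
      p∤L*L*v = coprime⇒prime∤ p-prime K²u⊥L²v (∣⇒∣square* K u p∣K)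

    w-∣L : p ∣ L → w (K * 2) (L * 2) u v p ≡ 1
    w-∣L p∣L = trans (w-split p-prime)
      (cong₂ _+_ (rootCount-d-unit p-prime p≢2 cs v (p∤K*K*u ∘ ∣⇒∣square* K u))
                 (rootCount-d-zero cs p∣L (p∤K*K*u ∘ ∣n⇒∣m*n (K * K))))
      where
      p∤K*K*u : ¬ p ∣ K * K * u
      p∤K*K*u = coprime⇒prime∤ p-prime (Coprime.sym K²u⊥L²v) (∣⇒∣square* L v p∣L)

    w-∤K∤L : ¬ p ∣ K → ¬ p ∣ L → w (K * 2) (L * 2) u v p ≡ 2
    w-∤K∤L p∤K p∤L = trans (w-split p-prime)
      (cong₂ _+_ (rootCount-d-unit p-prime p≢2 cs v p∤K) (rootCount-d-unit p-prime p≢2 cs u p∤L))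

  d-odd-pair : (2 ∣ K × ¬ 2 ∣ L) ⊎ (¬ 2 ∣ K × 2 ∣ L) → ∀ n → ¬ 2 ∣ d cs v K n × ¬ 2 ∣ d cs u L n
  d-odd-pair (inj₁ (2∣K , 2∤L)) n = d-odd 2∣K 2∤L K²u⊥L²v
    (λ 2∤u 2∤v → shift-even {u} {v} 2∤u 2∤v n)
    (λ 2∣u → shift-odd {u} {v} (inj₁ 2∣u) n)
  d-odd-pair (inj₂ (2∤K , 2∣L)) n = swap (d-odd 2∣L 2∤K (Coprime.sym K²u⊥L²v)
    (λ 2∤v 2∤u → shift-even {u} {v} 2∤u 2∤v n)
    (λ 2∣v → shift-odd {u} {v} (inj₂ 2∣v) n))

  w-2 : (2 ∣ K × ¬ 2 ∣ L) ⊎ (¬ 2 ∣ K × 2 ∣ L) → w (K * 2) (L * 2) u v 2 ≡ 0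
  w-2 one-even = rootCount-none 4 {f (K * 2) (L * 2) u v} λ n 4∣f →
    let 2∤d₁ , 2∤d₂ = d-odd-pair one-even n
    in prime∤* prime[2] 2∤d₁ 2∤d₂ (subst (2 ∣_) (f-halves n) (∣-trans (m∣m*n 2) 4∣f))

lemma6p5 : (k ℓ u v : ℕ) →
    0 < k → 2 ∣ k → 2 ∣ ℓ → k < ℓ → ℓ * ℓ < 3 * (k * k) →
    gcd k ℓ ≡ 2 →
    ((4 ∣ k × ¬ 4 ∣ ℓ) ⊎ (¬ 4 ∣ k × 4 ∣ ℓ)) →
    ((+ (k * k * u)) ℤ.- (+ (ℓ * ℓ * v)) ≡ + 4
      ⊎ (+ (k * k * u)) ℤ.- (+ (ℓ * ℓ * v)) ≡ ℤ.- (+ 4)) →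
    (w k ℓ u v 2 ≡ 0)
    × (∀ p → Prime p → p ≢ 2 → (p ∣ k ⊎ p ∣ ℓ) → w k ℓ u v p ≡ 1)
    × (∀ p → Prime p → p ≢ 2 → ¬ p ∣ k → ¬ p ∣ ℓ → w k ℓ u v p ≡ 2)
lemma6p5 .(K * 2) .(L * 2) u v _ (divides-refl K) (divides-refl L) _ _ _ one-of-4 ±4 =
    w-2 (Sum.map (Product.map 4∣*2⇒2∣ (_∘ 2∣⇒4∣*2)) (Product.map (_∘ 2∣⇒4∣*2) 4∣*2⇒2∣) one-of-4)
  , (λ p p-prime p≢2 → [ w-∣K p-prime p≢2 ∘ odd-prime∣*2⇒∣ p-prime p≢2
                       , w-∣L p-prime p≢2 ∘ odd-prime∣*2⇒∣ p-prime p≢2 ]′)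
  , (λ p p-prime p≢2 p∤k p∤ℓ → w-∤K∤L p-prime p≢2 (p∤k ∘ ∣m⇒∣m*n 2) (p∤ℓ ∘ ∣m⇒∣m*n 2))
  where open Halves K L u v (adjacent-halves K L u v ±4)
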